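{- Given $Y,Z\in\mathbb{N}^{\mathbb{N}}$, the following are equivalent: (1) $Y=\mathcal{J}^\omega(Z)$; (2) for every $n$ there exists a finite string $\sigma_n\subset Z$ with $|\sigma_n|>n$ such that $Y\restriction n=J^\omega(\sigma_n)$.
   Context: Finite strings are coded by natural numbers via a fixed computable coding with $\sigma\subset\tau\Rightarrow\sigma<\tau$. $\{e\}^\sigma(n)\downarrow$ means the $e$-th oracle machine with oracle $\sigma$ halts on $n$ within $|\sigma|$ steps; $\{e\}^Z_t(n)\downarrow$ means it halts in fewer than $t$ steps. Jump operator on reals: $t_{ -1}=1$, $t_n=\max\{t_{n-1}+1,\mu t(\{n\}^Z_t(n)\downarrow)\}$ (or $t_{n-1}+1$), $\mathcal{J}(Z)(n)=Z\restriction t_n$; $\mathcal{J}^\omega(Z)(n)=\mathcal{J}^{n+1}(Z)(0)$. Jump function on strings: for $\sigma$, $t_{ -1}=1$, $t_n=\max\{t_{n-1}+1,\mu t(\{n\}^{\sigma\restriction t}(n)\downarrow)\}$ (or $t_{n-1}+1$), $J(\sigma)=\langle\sigma\restriction t_0,\dots,\sigma\restriction t_{k-1}\rangle$ with $k$ least such that $t_k>|\sigma|$ (so $J(\sigma)$ is again a finite string and $J$ can be iterated). The $\omega$-Jump function: $J^\omega(\sigma)=\langle J(\sigma)(0),J^2(\sigma)(0),\dots,J^{m-1}(\sigma)(0)\rangle$, where $m$ is least with $J^m(\sigma)=\emptyset$. -}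

module Defs where

open import Level using (0ℓ)
open import Data.Bool using (Bool; true; false; if_then_else_; T)
open import Data.Maybe using (Maybe; just; nothing)
open import Data.Nat using (ℕ; zero; suc; _+_; _⊔_; _≤?_; pred)
open import Data.List using (List; []; _∷_; map; upTo; length; take; takeWhile; reverse)
open import Data.Product using (∃; _,_)
open import Relation.Nullary using (yes; no)
open import Axiom.ExcludedMiddle using (ExcludedMiddle)
open import Relation.Binary.PropositionalEquality using (_≡_)

-- Coding of finite strings (of naturals) by naturals.
-- tri k = k(k+1)/2, pair = Cantor pairing (injective).
-- code [] = 0, code (σ ++ [x]) = 1 + pair (code σ) x, so σ ⊂ τ ⇒ code σ < code τ.

tri : ℕ → ℕ
tri zero    = zero
tri (suc k) = suc k + tri k

pair : ℕ → ℕ → ℕ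
pair a b = tri (a + b) + b

codeRev : List ℕ → ℕ
codeRev []      = zero
codeRev (x ∷ r) = suc (pair (codeRev r) x)

code : List ℕ → ℕ
code σ = codeRev (reverse σ)

_↾_ : (ℕ → ℕ) → ℕ → List ℕ
Z ↾ t = map Z (upTo t)

_⊂_ : List ℕ → (ℕ → ℕ) → Set
σ ⊂ Z = σ ≡ (Z ↾ length σ)

lookupM : List ℕ → ℕ → Maybe ℕ
lookupM []      _       = nothing
lookupM (x ∷ _) zero    = just x
lookupM (_ ∷ σ) (suc i) = lookupM σ i

-- A machine with a one-way-infinite read-only oracle tape: in each step it
-- reads the oracle cell under the head (which starts at cell 0) and, given
-- its input and current state (state 0 initially), either halts or moves to
-- a new state and moves the head by at most one cell.  Hence a computation
-- of fewer than t steps only reads oracle cells < t.  (States are naturals,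
-- so arbitrary work memory is encoded in the state.)

data Move : Set where
  left right stay : Move

data Action : Set where
  halt : Action
  go   : ℕ → Move → Action

Machine : Set
Machine = ℕ → ℕ → ℕ → Action   -- input → state → oracle symbol read → action

move : Move → ℕ → ℕ
move left  h = pred h
move right h = suc h
move stay  h = h

run : Machine → ℕ → (ℕ → Maybe ℕ) → ℕ → ℕ → ℕ → Bool
run M n o zero    q h = false
run M n o (suc f) q h with o h
... | nothing = false
... | just v with M n q v
...   | halt     = true
...   | go q' mv = run M n o f q' (move mv h)

haltsR : (ℕ → Machine) → (ℕ → ℕ) → ℕ → ℕ → ℕ → Bool
haltsR Φ Z e n t = run (Φ e) n (λ i → just (Z i)) t 0 0

haltsS : (ℕ → Machine) → List ℕ → ℕ → ℕ → Bool
haltsS Φ σ e n = run (Φ e) n (lookupM σ) (length σ) 0 0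

-- The sequence t_n.  Classical (the jump is not computable), so we use an
-- excluded-middle oracle to decide whether μt exists.

-- least g w = least t ≤ w with g t = true (provided g w = true)
least : (ℕ → Bool) → ℕ → ℕ
least g zero    = zero
least g (suc w) = if g zero then zero else suc (least (λ t → g (suc t)) w)

nextT : ExcludedMiddle 0ℓ → (ℕ → Bool) → ℕ → ℕ
nextT lem g prev with lem {∃ λ t → T (g t)}
... | yes (w , _) = suc prev ⊔ least g w
... | no  _       = suc prev

-- tseq H n = t_n, where H n t is the halting condition for index n at bound t;
-- t_{-1} = 1.
tseq : ExcludedMiddle 0ℓ → (ℕ → ℕ → Bool) → ℕ → ℕ
tseq lem H zero    = nextT lem (H zero) 1
tseq lem H (suc n) = nextT lem (H (suc n)) (tseq lem H n)

𝒥 : ExcludedMiddle 0ℓ → (ℕ → Machine) → (ℕ → ℕ) → (ℕ → ℕ)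
𝒥 lem Φ Z n = code (Z ↾ tseq lem (λ m t → haltsR Φ Z m m t) n)

iter𝒥 : ExcludedMiddle 0ℓ → (ℕ → Machine) → ℕ → (ℕ → ℕ) → (ℕ → ℕ)
iter𝒥 lem Φ zero    Z = Z
iter𝒥 lem Φ (suc k) Z = 𝒥 lem Φ (iter𝒥 lem Φ k Z)

𝒥ω : ExcludedMiddle 0ℓ → (ℕ → Machine) → (ℕ → ℕ) → (ℕ → ℕ)
𝒥ω lem Φ Z n = iter𝒥 lem Φ (suc n) Z 0

tseqS : ExcludedMiddle 0ℓ → (ℕ → Machine) → List ℕ → ℕ → ℕ
tseqS lem Φ σ = tseq lem (λ m t → haltsS Φ (take t σ) m m)

-- J(σ) = ⟨σ↾t_0, …, σ↾t_{k-1}⟩, k least with t_k > |σ|.  (t_n is strictly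
-- increasing with t_n ≥ n+2, so k ≤ |σ| and the t_i with i < k are exactly
-- the initial run of t_0, …, t_{|σ|} that is ≤ |σ|.)
J : ExcludedMiddle 0ℓ → (ℕ → Machine) → List ℕ → List ℕ
J lem Φ σ =
  map (λ t → code (take t σ))
      (takeWhile (λ t → t ≤? length σ) (map (tseqS lem Φ σ) (upTo (suc (length σ)))))

-- J^ω(σ) = ⟨J(σ)(0), J²(σ)(0), …, J^{m-1}(σ)(0)⟩, m least with J^m(σ) = ∅.
-- Computed with fuel; |J(σ)| < |σ| for σ ≠ ∅ and J(∅) = ∅, so fuel |σ|+1
-- suffices.
Jωfuel : ExcludedMiddle 0ℓ → (ℕ → Machine) → ℕ → List ℕ → List ℕ
Jωfuel lem Φ zero    σ = []
Jωfuel lem Φ (suc f) σ with J lem Φ σ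
... | []      = []
... | (x ∷ _) = x ∷ Jωfuel lem Φ f (J lem Φ σ)

Jω : ExcludedMiddle 0ℓ → (ℕ → Machine) → List ℕ → List ℕ
Jω lem Φ σ = Jωfuel lem Φ (suc (length σ)) σ

module Submission where

-- The whole argument rests on one observation: a halting computation that takes
-- fewer than t steps reads only oracle cells below t (use principle).  Hence the
-- t-sequence of a string τ coincides with the t-sequence of a real X as long as
-- τ agrees with X far enough and the values involved stay below that bound
-- (tseq-agree, tseq-bound), purely as a fact about the operation nextT.
--
-- (1) ⇒ (2).  For a prefix X ↾ L with t_{k-1}(X) = L the string jump is exact:
--   J (X ↾ L) = 𝒥 X ↾ k  (J-restrict).  Iterating, suitable prefixes Z ↾ L
--   satisfy J^ω(Z ↾ L) = 𝒥^ω Z ↾ n with L > n (Jω-restrict).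
-- (2) ⇒ (1).  Codes dominate lengths and entries, so an entry J τ (p) ≤ m forces
--   t_p(τ) ≤ m, and then J τ (p) = 𝒥 X (p) whenever τ agrees with X below m
--   (J-entry-correct).  Iterating gives a modulus of continuity (continuity):
--   strings agreeing with Z below m whose J^ω-entries below K are prescribed
--   have J^d agreeing with 𝒥^d Z.  Choosing σ_n for a large n yields Y = 𝒥^ω Z.

open import Defs
open import Level using (0ℓ)
open import Data.Bool using (Bool; true; false; T)
open import Data.Maybe using (Maybe; just; nothing)
open import Data.Maybe.Properties using (just-injective)
open import Data.Nat using (ℕ; zero; suc; _+_; _⊔_; _≤_; _<_; _≤′_; _≤?_; _≤ᵇ_; z≤n; s≤s; ≤′-refl; ≤′-step)
open import Data.Nat.Properties
open import Data.List using (List; []; _∷_; map; upTo; applyUpTo; length; take; takeWhile; reverse)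
open import Data.List.Properties using (∷-injectiveˡ; map-applyUpTo; map-upTo; map-cong; length-map; length-upTo; length-take; take-all; length-reverse)
open import Data.List.Membership.Propositional using (_∈_)
open import Data.List.Relation.Unary.Any using (here; there)
open import Data.List.Relation.Unary.Any.Properties using (reverse⁺)
open import Data.Product using (∃-syntax; _×_; _,_; proj₁; proj₂)
open import Data.Unit using (tt)
open import Data.Empty using (⊥-elim)
open import Relation.Nullary using (¬_; yes; no)
open import Relation.Binary.PropositionalEquality using (_≡_; refl; sym; trans; cong; cong₂; subst; module ≡-Reasoning)
open import Relation.Binary.Definitions using (tri<; tri≈; tri>)
open import Axiom.ExcludedMiddle using (ExcludedMiddle)
open import Function using (_∘_)
open import Function.Bundles using (_⇔_; mk⇔)

open ≡-Reasoning

least-holds : ∀ (g : ℕ → Bool) w → T (g w) → T (g (least g w))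
least-holds g zero    gw = gw
least-holds g (suc w) gw with g zero in eq
... | true  = subst T (sym eq) tt
... | false = least-holds (g ∘ suc) w gw

least-minimal : ∀ (g : ℕ → Bool) w t → t < least g w → ¬ T (g t)
least-minimal g zero    t ()
least-minimal g (suc w) t t<l with g zero in eq
least-minimal g (suc w) t       ()        | true
least-minimal g (suc w) zero    _         | false = subst T eq
least-minimal g (suc w) (suc t) (s≤s t<l) | false = least-minimal (g ∘ suc) w t t<l

least-unique : ∀ {g₁ g₂ : ℕ → Bool} {m b₁ b₂} → (∀ t → t ≤ m → g₁ t ≡ g₂ t) →
  b₁ ≤ m → T (g₁ b₁) → (∀ t → t < b₁ → ¬ T (g₁ t)) →
  b₂ ≤ m → T (g₂ b₂) → (∀ t → t < b₂ → ¬ T (g₂ t)) → b₁ ≡ b₂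
least-unique {b₁ = b₁} {b₂} agree b₁≤m g₁b₁ min₁ b₂≤m g₂b₂ min₂ with <-cmp b₁ b₂
... | tri≈ _ eq _ = eq
... | tri< lt _ _ = ⊥-elim (min₂ b₁ lt (subst T (agree b₁ b₁≤m) g₁b₁))
... | tri> _ _ gt = ⊥-elim (min₁ b₂ gt (subst T (sym (agree b₂ b₂≤m)) g₂b₂))

module TSeq (lem : ExcludedMiddle 0ℓ) where

  data NextT (g : ℕ → Bool) (p : ℕ) : ℕ → Set where
    never : (∀ t → ¬ T (g t)) → NextT g p (suc p)
    first : ∀ b → T (g b) → (∀ t → t < b → ¬ T (g t)) → NextT g p (suc p ⊔ b)

  nextT-view : ∀ g p → NextT g p (nextT lem g p)
  nextT-view g p with lem {∃[ t ] T (g t)}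
  ... | yes (w , gw) = first (least g w) (least-holds g w gw) (least-minimal g w)
  ... | no  ∄t       = never (λ t gt → ∄t (t , gt))

  nextT-> : ∀ g p → suc p ≤ nextT lem g p
  nextT-> g p with nextT lem g p | nextT-view g p
  ... | _ | never _     = ≤-refl
  ... | _ | first b _ _ = m≤m⊔n (suc p) b

  nextT-agree : ∀ g₁ g₂ p m → (∀ t → t ≤ m → g₁ t ≡ g₂ t) →
    nextT lem g₁ p ≤ m → nextT lem g₂ p ≤ m → nextT lem g₁ p ≡ nextT lem g₂ p
  nextT-agree g₁ g₂ p m agree
    with nextT lem g₁ p | nextT-view g₁ p | nextT lem g₂ p | nextT-view g₂ p
  ... | _ | never _  | _ | never _ = λ _ _ → refl
  ... | _ | never ∄₁ | _ | first b g₂b _ = λ _ le₂ →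
    ⊥-elim (∄₁ b (subst T (sym (agree b (m⊔n≤o⇒n≤o (suc p) b le₂))) g₂b))
  ... | _ | first b g₁b _ | _ | never ∄₂ = λ le₁ _ →
    ⊥-elim (∄₂ b (subst T (agree b (m⊔n≤o⇒n≤o (suc p) b le₁)) g₁b))
  ... | _ | first b₁ g₁b₁ min₁ | _ | first b₂ g₂b₂ min₂ = λ le₁ le₂ →
    cong (suc p ⊔_) (least-unique agree (m⊔n≤o⇒n≤o (suc p) b₁ le₁) g₁b₁ min₁
                                        (m⊔n≤o⇒n≤o (suc p) b₂ le₂) g₂b₂ min₂)

  nextT-bound : ∀ g₁ g₂ p m → (∀ t → t ≤ m → g₁ t ≡ g₂ t) → (∀ t → m ≤ t → g₁ t ≡ g₁ m) →
    nextT lem g₂ p ≤ m → nextT lem g₁ p ≤ m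
  nextT-bound g₁ g₂ p m agree const le₂ with nextT lem g₁ p | nextT-view g₁ p
  ... | _ | never _         = ≤-trans (nextT-> g₂ p) le₂
  ... | _ | first b g₁b min = ⊔-lub (≤-trans (nextT-> g₂ p) le₂) b≤m
    where
    -- a least witness beyond m would make g₁ m a smaller witness
    b≤m : b ≤ m
    b≤m with b ≤? m
    ... | yes le  = le
    ... | no  b≰m = ⊥-elim (min m (≰⇒> b≰m) (subst T (const b (<⇒≤ (≰⇒> b≰m))) g₁b))

  tseq-step : ∀ H n → suc (tseq lem H n) ≤ tseq lem H (suc n)
  tseq-step H n = nextT-> (H (suc n)) (tseq lem H n)

  tseq-≥ : ∀ H n → suc (suc n) ≤ tseq lem H n
  tseq-≥ H zero    = nextT-> (H zero) 1
  tseq-≥ H (suc n) = ≤-trans (s≤s (tseq-≥ H n)) (tseq-step H n)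

  tseq-mono : ∀ H {i j} → i ≤ j → tseq lem H i ≤ tseq lem H j
  tseq-mono H i≤j = along (≤⇒≤′ i≤j)
    where
    along : ∀ {i j} → i ≤′ j → tseq lem H i ≤ tseq lem H j
    along ≤′-refl         = ≤-refl
    along (≤′-step {n} p) = ≤-trans (along p) (<⇒≤ (tseq-step H n))

  tseq-≤-prev : ∀ H {m} p → tseq lem H (suc p) ≤ m → tseq lem H p ≤ m
  tseq-≤-prev H p le = ≤-trans (n≤1+n _) (≤-trans (tseq-step H p) le)

  tseq-agree : ∀ H₁ H₂ m → (∀ n t → t ≤ m → H₁ n t ≡ H₂ n t) →
    ∀ p → tseq lem H₁ p ≤ m → tseq lem H₂ p ≤ m → tseq lem H₁ p ≡ tseq lem H₂ p
  tseq-agree H₁ H₂ m agree zero    = nextT-agree (H₁ 0) (H₂ 0) 1 m (agree 0)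
  tseq-agree H₁ H₂ m agree (suc p) le₁ le₂ = begin
    nextT lem (H₁ (suc p)) (tseq lem H₁ p) ≡⟨ cong (nextT lem (H₁ (suc p))) same ⟩
    nextT lem (H₁ (suc p)) (tseq lem H₂ p) ≡⟨ nextT-agree (H₁ (suc p)) (H₂ (suc p)) _ m (agree (suc p))
                                                (subst (λ s → nextT lem (H₁ (suc p)) s ≤ m) same le₁) le₂ ⟩
    nextT lem (H₂ (suc p)) (tseq lem H₂ p) ∎
    where
    same = tseq-agree H₁ H₂ m agree p (tseq-≤-prev H₁ p le₁) (tseq-≤-prev H₂ p le₂)

  tseq-bound : ∀ H₁ H₂ m → (∀ n t → t ≤ m → H₁ n t ≡ H₂ n t) → (∀ n t → m ≤ t → H₁ n t ≡ H₁ n m) →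
    ∀ p → tseq lem H₂ p ≤ m → tseq lem H₁ p ≤ m
  tseq-bound H₁ H₂ m agree const zero = nextT-bound (H₁ 0) (H₂ 0) 1 m (agree 0) (const 0)
  tseq-bound H₁ H₂ m agree const (suc p) le₂ =
    subst (λ s → nextT lem (H₁ (suc p)) s ≤ m) (sym same)
      (nextT-bound (H₁ (suc p)) (H₂ (suc p)) _ m (agree (suc p)) (const (suc p)) le₂)
    where
    le₂′ = tseq-≤-prev H₂ p le₂
    same = tseq-agree H₁ H₂ m agree p (tseq-bound H₁ H₂ m agree const p le₂′) le₂′

lookupM-< : ∀ (τ : List ℕ) i {v} → lookupM τ i ≡ just v → i < length τ
lookupM-< (x ∷ τ) zero    _  = s≤s z≤n
lookupM-< (x ∷ τ) (suc i) eq = s≤s (lookupM-< τ i eq)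

lookupM-exists : ∀ (τ : List ℕ) i → i < length τ → ∃[ x ] lookupM τ i ≡ just x
lookupM-exists (x ∷ τ) zero    _         = x , refl
lookupM-exists (x ∷ τ) (suc i) (s≤s i<n) = lookupM-exists τ i i<n

lookupM-∈ : ∀ (σ : List ℕ) i {x} → lookupM σ i ≡ just x → x ∈ σ
lookupM-∈ (y ∷ σ) zero    refl = here refl
lookupM-∈ (y ∷ σ) (suc i) eq   = there (lookupM-∈ σ i eq)

lookupM-take : ∀ (τ : List ℕ) t c → c < t → lookupM (take t τ) c ≡ lookupM τ c
lookupM-take []      (suc t) c       _         = refl
lookupM-take (x ∷ τ) (suc t) zero    _         = refl
lookupM-take (x ∷ τ) (suc t) (suc c) (s≤s c<t) = lookupM-take τ t c c<t

lookupM-applyUpTo : ∀ (f : ℕ → ℕ) n i → i < n → lookupM (applyUpTo f n) i ≡ just (f i)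
lookupM-applyUpTo f (suc n) zero    _         = refl
lookupM-applyUpTo f (suc n) (suc i) (s≤s i<n) = lookupM-applyUpTo (f ∘ suc) n i i<n

length-take-≤ : ∀ (τ : List ℕ) t → t ≤ length τ → length (take t τ) ≡ t
length-take-≤ τ t le = trans (length-take t τ) (m≤n⇒m⊓n≡m le)

length-↾ : ∀ (Z : ℕ → ℕ) t → length (Z ↾ t) ≡ t
length-↾ Z t = trans (length-map Z (upTo t)) (length-upTo t)

Agrees : ℕ → List ℕ → (ℕ → ℕ) → Set
Agrees m τ X = ∀ i → i < m → lookupM τ i ≡ just (X i)

agrees-mono : ∀ {m m′} τ {X} → m ≤ m′ → Agrees m′ τ X → Agrees m τ X
agrees-mono τ m≤m′ ag i i<m = ag i (<-≤-trans i<m m≤m′)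

agrees-length : ∀ m τ X → Agrees m τ X → m ≤ length τ
agrees-length zero    τ X ag = z≤n
agrees-length (suc m) τ X ag = lookupM-< τ m (ag m ≤-refl)

↾-agrees : ∀ Z t → Agrees t (Z ↾ t) Z
↾-agrees Z t i i<t = trans (cong (λ σ → lookupM σ i) (map-upTo Z t)) (lookupM-applyUpTo Z t i i<t)

⊂-agrees : ∀ {σ Z} → σ ⊂ Z → Agrees (length σ) σ Z
⊂-agrees {σ} {Z} σ⊂Z i i<n = trans (cong (λ ρ → lookupM ρ i) σ⊂Z) (↾-agrees Z (length σ) i i<n)

take-applyUpTo : ∀ τ t (f : ℕ → ℕ) → Agrees t τ f → take t τ ≡ applyUpTo f t
take-applyUpTo τ       zero    f ag = refl
take-applyUpTo []      (suc t) f ag with ag 0 (s≤s z≤n)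
... | ()
take-applyUpTo (x ∷ τ) (suc t) f ag =
  cong₂ _∷_ (just-injective (ag 0 (s≤s z≤n))) (take-applyUpTo τ t (f ∘ suc) (λ i i<t → ag (suc i) (s≤s i<t)))

take-agrees : ∀ τ t X → Agrees t τ X → take t τ ≡ X ↾ t
take-agrees τ t X ag = trans (take-applyUpTo τ t X ag) (sym (map-upTo X t))

take-↾ : ∀ X {L} t → t ≤ L → take t (X ↾ L) ≡ X ↾ t
take-↾ X {L} t t≤L = take-agrees (X ↾ L) t X (agrees-mono (X ↾ L) t≤L (↾-agrees X L))

↾-suc : ∀ (Z : ℕ → ℕ) n → Z ↾ suc n ≡ Z 0 ∷ (Z ∘ suc) ↾ n
↾-suc Z n = cong (Z 0 ∷_) (trans (map-applyUpTo suc Z n) (sym (map-upTo (Z ∘ suc) n)))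

tri-≥ : ∀ n → n ≤ tri n
tri-≥ zero    = z≤n
tri-≥ (suc n) = m≤m+n (suc n) (tri n)

pair-≥ˡ : ∀ a b → a ≤ pair a b
pair-≥ˡ a b = ≤-trans (m≤m+n a b) (≤-trans (tri-≥ (a + b)) (m≤m+n (tri (a + b)) b))

pair-≥ʳ : ∀ a b → b ≤ pair a b
pair-≥ʳ a b = m≤n+m b (tri (a + b))

codeRev-length : ∀ r → length r ≤ codeRev r
codeRev-length []      = z≤n
codeRev-length (x ∷ r) = s≤s (≤-trans (codeRev-length r) (pair-≥ˡ (codeRev r) x))

codeRev-∈ : ∀ {x} r → x ∈ r → x ≤ codeRev r
codeRev-∈ (y ∷ r) (here refl) = ≤-trans (pair-≥ʳ (codeRev r) y) (n≤1+n _)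
codeRev-∈ (y ∷ r) (there x∈r) = ≤-trans (codeRev-∈ r x∈r) (≤-trans (pair-≥ˡ (codeRev r) y) (n≤1+n _))

code-length : ∀ σ → length σ ≤ code σ
code-length σ = subst (_≤ code σ) (length-reverse σ) (codeRev-length (reverse σ))

code-entry : ∀ σ i {x} → lookupM σ i ≡ just x → x ≤ code σ
code-entry σ i eq = codeRev-∈ (reverse σ) (reverse⁺ (lookupM-∈ σ i eq))

-- Use principle: a run of f steps from head position h reads only cells below h + f.

move-≤ : ∀ mv h → move mv h ≤ suc h
move-≤ left  zero    = z≤n
move-≤ left  (suc h) = ≤-trans (n≤1+n h) (n≤1+n (suc h))
move-≤ right h       = ≤-refl
move-≤ stay  h       = n≤1+n h

run-agree : ∀ (M : Machine) n (o₁ o₂ : ℕ → Maybe ℕ) f q h →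
  (∀ c → c < h + f → o₁ c ≡ o₂ c) → run M n o₁ f q h ≡ run M n o₂ f q h
run-agree M n o₁ o₂ zero    q h agree = refl
run-agree M n o₁ o₂ (suc f) q h agree
  with o₁ h | o₂ h | agree h (subst (h <_) (sym (+-suc h f)) (s≤s (m≤m+n h f)))
... | nothing | .nothing | refl = refl
... | just v  | .(just v) | refl with M n q v
...   | halt     = refl
...   | go q′ mv = run-agree M n o₁ o₂ f q′ (move mv h) (λ c lt → agree c (read-before c lt))
  where
  read-before : ∀ c → c < move mv h + f → c < h + suc f
  read-before c lt = subst (c <_) (sym (+-suc h f)) (≤-trans lt (+-monoˡ-≤ f (move-≤ mv h)))

halts-agree : ∀ (Φ : ℕ → Machine) m τ X t e n → Agrees m τ X → t ≤ m →
  haltsS Φ (take t τ) e n ≡ haltsR Φ X e n t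
halts-agree Φ m τ X t e n ag t≤m = begin
  run (Φ e) n (lookupM (take t τ)) (length (take t τ)) 0 0
    ≡⟨ cong (λ f → run (Φ e) n (lookupM (take t τ)) f 0 0) (length-take-≤ τ t (≤-trans t≤m (agrees-length m τ X ag))) ⟩
  run (Φ e) n (lookupM (take t τ)) t 0 0
    ≡⟨ run-agree (Φ e) n _ _ t 0 0 (λ c c<t → trans (lookupM-take τ t c c<t) (ag c (<-≤-trans c<t t≤m))) ⟩
  run (Φ e) n (λ i → just (X i)) t 0 0 ∎

≤ᵇ-true : ∀ {a L} → (a ≤ᵇ L) ≡ true → a ≤ L
≤ᵇ-true {a} {L} eq = ≤ᵇ⇒≤ a L (subst T (sym eq) tt)

≤ᵇ-false : ∀ {a L} → (a ≤ᵇ L) ≡ false → ¬ a ≤ L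
≤ᵇ-false eq le = subst T eq (≤⇒≤ᵇ le)

lookupM-takeWhile : ∀ (c f : ℕ → ℕ) L N p {v} →
  lookupM (map c (takeWhile (λ t → t ≤? L) (applyUpTo f N))) p ≡ just v → f p ≤ L × v ≡ c (f p)
lookupM-takeWhile c f L (suc N) p eq with f zero ≤ᵇ L in le
lookupM-takeWhile c f L (suc N) zero    refl | true = ≤ᵇ-true le , refl
lookupM-takeWhile c f L (suc N) (suc p) eq   | true = lookupM-takeWhile c (f ∘ suc) L N p eq

takeWhile-applyUpTo : ∀ (f : ℕ → ℕ) L N k → (∀ q → q < k → f q ≤ L) → L < f k → k < N →
  takeWhile (λ t → t ≤? L) (applyUpTo f N) ≡ applyUpTo f k
takeWhile-applyUpTo f L (suc N) k below above k<N with f zero ≤ᵇ L in le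
takeWhile-applyUpTo f L (suc N) zero    below above _         | true  = ⊥-elim (<⇒≱ above (≤ᵇ-true le))
takeWhile-applyUpTo f L (suc N) zero    below above _         | false = refl
takeWhile-applyUpTo f L (suc N) (suc k) below above (s≤s k<N) | true  =
  cong (f 0 ∷_) (takeWhile-applyUpTo (f ∘ suc) L N k (λ q q<k → below (suc q) (s≤s q<k)) above k<N)
takeWhile-applyUpTo f L (suc N) (suc k) below above _         | false = ⊥-elim (≤ᵇ-false le (below 0 (s≤s z≤n)))

module Jumps (lem : ExcludedMiddle 0ℓ) (Φ : ℕ → Machine) where
  open TSeq lem

  HR : (ℕ → ℕ) → ℕ → ℕ → Bool
  HR X n t = haltsR Φ X n n t

  HS : List ℕ → ℕ → ℕ → Bool
  HS τ n t = haltsS Φ (take t τ) n n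

  tR : (ℕ → ℕ) → ℕ → ℕ
  tR X = tseq lem (HR X)

  tS : List ℕ → ℕ → ℕ
  tS τ = tseqS lem Φ τ

  tseq-agrees : ∀ m τ X → Agrees m τ X → ∀ p → tS τ p ≤ m → tR X p ≤ m → tS τ p ≡ tR X p
  tseq-agrees m τ X ag = tseq-agree (HS τ) (HR X) m (λ n t → halts-agree Φ m τ X t n n ag)

  -- A prefix X ↾ L has no more cells to consult beyond L, so its halting predicate is constant from L on.
  HS-stable : ∀ X L n t → L ≤ t → HS (X ↾ L) n t ≡ HS (X ↾ L) n L
  HS-stable X L n t L≤t = cong (λ σ → haltsS Φ σ n n)
    (trans (take-all t (X ↾ L) (subst (_≤ t) (sym (length-↾ X L)) L≤t))
           (sym (take-all L (X ↾ L) (≤-reflexive (length-↾ X L)))))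

  tseq-restrict : ∀ X L p → tR X p ≤ L → tS (X ↾ L) p ≡ tR X p
  tseq-restrict X L p le =
    tseq-agrees L (X ↾ L) X (↾-agrees X L) p (tseq-bound (HS (X ↾ L)) (HR X) L agree (HS-stable X L) p le) le
    where
    agree = λ n t t≤L → halts-agree Φ L (X ↾ L) X t n n (↾-agrees X L) t≤L

  -- Since t_q ≥ q + 2, at most L of the t-values are ≤ L.
  tseq-count : ∀ X L k → (∀ q → q < k → tR X q ≤ L) → k ≤ L
  tseq-count X L zero    _     = z≤n
  tseq-count X L (suc j) below = ≤-trans (≤-trans (n≤1+n _) (tseq-≥ (HR X) j)) (below j ≤-refl)

  J-unfold : ∀ τ → J lem Φ τ ≡
    map (λ t → code (take t τ)) (takeWhile (λ t → t ≤? length τ) (applyUpTo (tS τ) (suc (length τ))))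
  J-unfold τ = cong (λ l → map (λ t → code (take t τ)) (takeWhile (λ t → t ≤? length τ) l))
                    (map-upTo (tS τ) (suc (length τ)))

  J-restrict : ∀ X L k → (∀ q → q < k → tR X q ≤ L) → L < tS (X ↾ L) k → J lem Φ (X ↾ L) ≡ 𝒥 lem Φ X ↾ k
  J-restrict X L k below above = begin
    J lem Φ τ
      ≡⟨ J-unfold τ ⟩
    map c (takeWhile (λ t → t ≤? length τ) (applyUpTo (tS τ) (suc (length τ))))
      ≡⟨ cong (λ ℓ → map c (takeWhile (λ t → t ≤? ℓ) (applyUpTo (tS τ) (suc ℓ)))) (length-↾ X L) ⟩
    map c (takeWhile (λ t → t ≤? L) (applyUpTo (tS τ) (suc L)))
      ≡⟨ cong (map c) (takeWhile-applyUpTo (tS τ) L (suc L) k below′ above (s≤s (tseq-count X L k below))) ⟩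
    map c (applyUpTo (tS τ) k)
      ≡⟨ map-applyUpTo (tS τ) c k ⟩
    applyUpTo (c ∘ tS τ) k
      ≡⟨ applyUpTo-local (c ∘ tS τ) (𝒥 lem Φ X) k entry ⟩
    applyUpTo (𝒥 lem Φ X) k
      ≡⟨ sym (map-upTo (𝒥 lem Φ X) k) ⟩
    𝒥 lem Φ X ↾ k ∎
    where
    τ = X ↾ L
    c = λ t → code (take t τ)
    below′ : ∀ q → q < k → tS τ q ≤ L
    below′ q q<k = ≤-trans (≤-reflexive (tseq-restrict X L q (below q q<k))) (below q q<k)
    entry : ∀ q → q < k → c (tS τ q) ≡ 𝒥 lem Φ X q
    entry q q<k = cong code (trans (cong (λ t → take t τ) (tseq-restrict X L q (below q q<k)))
                                   (take-↾ X (tR X q) (below q q<k)))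
    applyUpTo-local : ∀ (f g : ℕ → ℕ) n → (∀ i → i < n → f i ≡ g i) → applyUpTo f n ≡ applyUpTo g n
    applyUpTo-local f g zero    _  = refl
    applyUpTo-local f g (suc n) eq =
      cong₂ _∷_ (eq 0 (s≤s z≤n)) (applyUpTo-local (f ∘ suc) (g ∘ suc) n (λ i i<n → eq (suc i) (s≤s i<n)))

  J-entry : ∀ τ p {v} → lookupM (J lem Φ τ) p ≡ just v → tS τ p ≤ length τ × v ≡ code (take (tS τ p) τ)
  J-entry τ p eq = lookupM-takeWhile (λ t → code (take t τ)) (tS τ) (length τ) (suc (length τ)) p
                     (trans (cong (λ l → lookupM l p) (sym (J-unfold τ))) eq)

  J-entry-dominates : ∀ τ i {w} → lookupM (J lem Φ τ) i ≡ just w → ∀ p → p ≤ suc i →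
    ∃[ v ] lookupM τ p ≡ just v × v ≤ w
  J-entry-dominates τ i eq p p≤1+i with J-entry τ i eq
  ... | t≤|τ| , refl = v , trans (sym (lookupM-take τ t p p<t)) τp , code-entry (take t τ) p τp
    where
    t = tS τ i
    p<t = <-≤-trans (s≤s p≤1+i) (tseq-≥ (HS τ) i)
    found = lookupM-exists (take t τ) p (subst (p <_) (sym (length-take-≤ τ t t≤|τ|)) p<t)
    v = proj₁ found
    τp = proj₂ found

  iterJ : ℕ → List ℕ → List ℕ
  iterJ zero    ρ = ρ
  iterJ (suc k) ρ = iterJ k (J lem Φ ρ)

  iterJ-dominates : ∀ j ρ {w} → lookupM (iterJ j ρ) 0 ≡ just w → ∀ p → p ≤ j →
    ∃[ v ] lookupM ρ p ≡ just v × v ≤ w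
  iterJ-dominates zero    ρ {w} eq zero z≤n = w , eq , ≤-refl
  iterJ-dominates (suc j) ρ eq p p≤1+j with iterJ-dominates j (J lem Φ ρ) eq j ≤-refl
  ... | v′ , Jρj , v′≤w with J-entry-dominates ρ j Jρj p p≤1+j
  ...   | v , ρp , v≤v′ = v , ρp , ≤-trans v≤v′ v′≤w

  J-entry-correct : ∀ m τ X → Agrees m τ X → ∀ p {v} → lookupM (J lem Φ τ) p ≡ just v →
    v ≤ m → tR X p ≤ m → v ≡ 𝒥 lem Φ X p
  J-entry-correct m τ X ag p eq v≤m tR≤m with J-entry τ p eq
  ... | t≤|τ| , refl = cong code (begin
    take (tS τ p) τ    ≡⟨ cong (λ t → take t τ) same ⟩
    take (tR X p) τ    ≡⟨ take-agrees τ (tR X p) X (agrees-mono τ tR≤m ag) ⟩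
    X ↾ tR X p         ∎)
    where
    tS≤m : tS τ p ≤ m
    tS≤m = ≤-trans (≤-reflexive (sym (length-take-≤ τ (tS τ p) t≤|τ|)))
                   (≤-trans (code-length (take (tS τ p) τ)) v≤m)
    same = tseq-agrees m τ X ag p tS≤m tR≤m

  J-agrees : ∀ m w X τ → Agrees (w ⊔ tR X m) τ X → lookupM (iterJ (suc m) τ) 0 ≡ just w →
    Agrees m (J lem Φ τ) (𝒥 lem Φ X)
  J-agrees m w X τ ag eq p p<m with iterJ-dominates m (J lem Φ τ) eq p (<⇒≤ p<m)
  ... | v , Jτp , v≤w = trans Jτp (cong just (J-entry-correct (w ⊔ tR X m) τ X ag p Jτp
                          (≤-trans v≤w (m≤m⊔n w (tR X m)))
                          (≤-trans (tseq-mono (HR X) (<⇒≤ p<m)) (m≤n⊔m w (tR X m)))))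

  -- 𝒥^d (𝒥 X) = 𝒥 (𝒥^d X), to relate iterJ (which applies J first) with iter𝒥.
  iter𝒥-comm : ∀ d X → iter𝒥 lem Φ d (𝒥 lem Φ X) ≡ 𝒥 lem Φ (iter𝒥 lem Φ d X)
  iter𝒥-comm zero    X = refl
  iter𝒥-comm (suc d) X = cong (𝒥 lem Φ) (iter𝒥-comm d X)

  HeadsMatch : List ℕ → (ℕ → ℕ) → ℕ → Set
  HeadsMatch τ W K = ∀ j → j < K → lookupM (iterJ (suc j) τ) 0 ≡ just (W j)

  continuity : ∀ d X (W : ℕ → ℕ) P → ∃[ m ] ∃[ K ]
    (∀ τ → Agrees m τ X → HeadsMatch τ W K → Agrees P (iterJ d τ) (iter𝒥 lem Φ d X))
  continuity zero    X W P = P , 0 , λ τ ag _ → ag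
  continuity (suc d) X W P with continuity d (𝒥 lem Φ X) (W ∘ suc) P
  ... | m , K , modulus = W m ⊔ tR X m , suc (K ⊔ m) , λ τ ag heads →
    subst (Agrees P (iterJ d (J lem Φ τ))) (iter𝒥-comm d X)
      (modulus (J lem Φ τ) (J-agrees m (W m) X τ ag (heads m (s≤s (m≤n⊔m K m))))
                           (λ j j<K → heads (suc j) (s≤s (≤-trans j<K (m≤m⊔n K m)))))

  Jωfuel-entry : ∀ f σ j {y} → lookupM (Jωfuel lem Φ f σ) j ≡ just y → lookupM (iterJ (suc j) σ) 0 ≡ just y
  Jωfuel-entry (suc f) σ j eq with J lem Φ σ in eJ
  Jωfuel-entry (suc f) σ zero    refl | x ∷ xs = refl
  Jωfuel-entry (suc f) σ (suc j) eq   | x ∷ xs =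
    subst (λ ρ → lookupM (iterJ (suc j) ρ) 0 ≡ just _) eJ (Jωfuel-entry f (J lem Φ σ) j eq)

  Jωfuel-nil : ∀ f σ → J lem Φ σ ≡ [] → Jωfuel lem Φ (suc f) σ ≡ []
  Jωfuel-nil f σ eq with J lem Φ σ
  ... | [] = refl

  Jωfuel-cons : ∀ f σ {x xs} → J lem Φ σ ≡ x ∷ xs → Jωfuel lem Φ (suc f) σ ≡ x ∷ Jωfuel lem Φ f (x ∷ xs)
  Jωfuel-cons f σ eq with J lem Φ σ in eJ
  ... | _ ∷ _ = cong₂ _∷_ (∷-injectiveˡ eq) (cong (Jωfuel lem Φ f) (trans eJ eq))

  𝒥ω-shift : ∀ X i → 𝒥ω lem Φ (𝒥 lem Φ X) i ≡ 𝒥ω lem Φ X (suc i)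
  𝒥ω-shift X i = cong (λ F → 𝒥 lem Φ F 0) (iter𝒥-comm i X)

  Jω-restrict : ∀ n X → ∃[ L ] (n < L × ∀ f → L < f → Jωfuel lem Φ f (X ↾ L) ≡ 𝒥ω lem Φ X ↾ n)
  Jω-restrict zero X = 1 , s≤s z≤n , λ { (suc f) _ → Jωfuel-nil f (X ↾ 1) empty }
    where
    empty = J-restrict X 1 0 (λ _ ()) (subst (_< tS (X ↾ 1) 0) (length-↾ X 1) (tseq-≥ (HS (X ↾ 1)) 0))
  Jω-restrict (suc n) X with Jω-restrict n (𝒥 lem Φ X)
  ... | suc k , s≤s n≤k , F = tR X k , <-≤-trans (s≤s (s≤s n≤k)) (tseq-≥ (HR X) k) , result
    where
    τ = X ↾ tR X k
    t-above : tR X k < tS τ (suc k)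
    t-above = subst (λ s → suc s ≤ tS τ (suc k)) (tseq-restrict X (tR X k) k ≤-refl) (tseq-step (HS τ) k)
    jump : J lem Φ τ ≡ 𝒥 lem Φ X ↾ suc k
    jump = J-restrict X (tR X k) (suc k) (λ q q<1+k → tseq-mono (HR X) (≤-pred q<1+k)) t-above
    result : ∀ f → tR X k < f → Jωfuel lem Φ f τ ≡ 𝒥ω lem Φ X ↾ suc n
    result (suc f) lt = begin
      Jωfuel lem Φ (suc f) τ                            ≡⟨ Jωfuel-cons f τ jump ⟩
      𝒥 lem Φ X 0 ∷ Jωfuel lem Φ f (𝒥 lem Φ X ↾ suc k) ≡⟨ cong (_ ∷_) (F f (<-≤-trans (tseq-≥ (HR X) k) (≤-pred lt))) ⟩
      𝒥 lem Φ X 0 ∷ 𝒥ω lem Φ (𝒥 lem Φ X) ↾ n           ≡⟨ cong (_ ∷_) (map-cong (𝒥ω-shift X) (upTo n)) ⟩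
      𝒥ω lem Φ X 0 ∷ (𝒥ω lem Φ X ∘ suc) ↾ n             ≡⟨ sym (↾-suc _ n) ⟩
      𝒥ω lem Φ X ↾ suc n                                ∎

  jump-to-approximations : ∀ Y Z → (∀ n → Y n ≡ 𝒥ω lem Φ Z n) →
    ∀ n → ∃[ σ ] (σ ⊂ Z × n < length σ × Y ↾ n ≡ Jω lem Φ σ)
  jump-to-approximations Y Z Y≡ n with Jω-restrict n Z
  ... | L , n<L , F = Z ↾ L , cong (Z ↾_) (sym |σ|≡L) , subst (n <_) (sym |σ|≡L) n<L ,
                      trans (map-cong Y≡ (upTo n)) (sym (F _ (s≤s (≤-reflexive (sym |σ|≡L)))))
    where
    |σ|≡L = length-↾ Z L

  approximations-to-jump : ∀ Y Z → (∀ n → ∃[ σ ] (σ ⊂ Z × n < length σ × Y ↾ n ≡ Jω lem Φ σ)) →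
    ∀ k → Y k ≡ 𝒥ω lem Φ Z k
  approximations-to-jump Y Z approx k with continuity (suc k) Z Y 1
  ... | m , K , modulus with approx (m ⊔ K ⊔ suc k)
  ... | σ , σ⊂Z , n<|σ| , Y↾n≡Jωσ = just-injective (trans (sym (heads k k<n)) 𝒥ω-head)
    where
    n = m ⊔ K ⊔ suc k
    k<n = m≤n⊔m (m ⊔ K) (suc k)
    heads : ∀ j → j < n → lookupM (iterJ (suc j) σ) 0 ≡ just (Y j)
    heads j j<n = Jωfuel-entry (suc (length σ)) σ j (trans (cong (λ ρ → lookupM ρ j) (sym Y↾n≡Jωσ)) (↾-agrees Y n j j<n))
    m≤n = ≤-trans (m≤m⊔n m K) (m≤m⊔n (m ⊔ K) (suc k))
    K≤n = ≤-trans (m≤n⊔m m K) (m≤m⊔n (m ⊔ K) (suc k))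
    𝒥ω-head : lookupM (iterJ (suc k) σ) 0 ≡ just (𝒥ω lem Φ Z k)
    𝒥ω-head = modulus σ (agrees-mono σ (≤-trans m≤n (<⇒≤ n<|σ|)) (⊂-agrees σ⊂Z))
                        (λ j j<K → heads j (<-≤-trans j<K K≤n)) 0 (s≤s z≤n)

lemma5p11 : (lem : ExcludedMiddle 0ℓ) (Φ : ℕ → Machine) (Y Z : ℕ → ℕ) →
    ((∀ n → Y n ≡ 𝒥ω lem Φ Z n) ⇔
    (∀ n → ∃[ σ ] (σ ⊂ Z × n < length σ × Y ↾ n ≡ Jω lem Φ σ)))
lemma5p11 lem Φ Y Z = mk⇔ (jump-to-approximations Y Z) (approximations-to-jump Y Z)
  where open Jumps lem Φ
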